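{- Let $G$ be a finite simple graph, $X$ a solution, $v\in AWS(X)$ such that $X\cup\{v\}$ is a solution, $u\in N(v)\cap AWS(X)$, and $Z=X\cup\{u,v\}$. Then $u\in\mathrm{Del}_{AWS}(X,v)$ if and only if $u$ has a neighbour $w$ in $Z$ which is incomparable to $v$ in $G[Z]$.
   Context: For $S\subseteq V$, $N_S(u)=N(u)\cap S$; in $G[S]$, $a,b$ are comparable if $N_S(a)\subseteq N_S(b)$ or $N_S(b)\subseteq N_S(a)$, incomparable otherwise; $u\in S$ is weak-simplicial in $G[S]$ if $N_S(u)$ is independent and any two vertices of $N_S(u)$ are comparable in $G[S]$. A solution is $X\subseteq V$ with $G[X]$ chordal bipartite (bipartite, no induced cycle of length $\ge6$). $WS(S)$ is the set of weak-simplicial vertices of $G[S]$. $AWS(X)=\{u\in V\setminus X: u\in WS(X\cup\{u\})\}$. $N^{1:2}(v)$ is the set of vertices at distance $1$ or $2$ from $v$ in $G$. $\mathrm{Del}_{AWS}(X,v)=\{u\in N^{1:2}(v)\cap AWS(X): u\notin WS(X\cup\{u,v\})\}$. -}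

module Defs where

open import Data.Nat using (ℕ; zero; suc; _≤_)
open import Data.Fin using (Fin; toℕ)
open import Data.Fin.Subset using (Subset; _∈_; _∉_; _∪_; ⁅_⁆)
open import Data.Product using (Σ; ∃; ∃-syntax; _×_)
open import Data.Sum using (_⊎_)
open import Relation.Nullary using (¬_; Dec)
open import Relation.Binary.PropositionalEquality using (_≡_; _≢_)
open import Function.Definitions using (Injective)
open import Function.Bundles using (_⇔_)

record Graph (n : ℕ) : Set₁ where
  field
    _~_    : Fin n → Fin n → Set
    ~-sym  : ∀ {a b} → a ~ b → b ~ a
    ~-irr  : ∀ {a} → ¬ (a ~ a)
    ~-dec  : ∀ a b → Dec (a ~ b)

module _ {n : ℕ} (G : Graph n) where
  open Graph G

  NSub : Subset n → Fin n → Fin n → Set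
  NSub S a b = ∀ x → x ∈ S → a ~ x → b ~ x

  Comparable : Subset n → Fin n → Fin n → Set
  Comparable S a b = NSub S a b ⊎ NSub S b a

  Incomparable : Subset n → Fin n → Fin n → Set
  Incomparable S a b = ¬ Comparable S a b

  WeakSimplicial : Subset n → Fin n → Set
  WeakSimplicial S u =
    u ∈ S ×
    (∀ x y → x ∈ S → y ∈ S → u ~ x → u ~ y → ¬ (x ~ y)) ×
    (∀ x y → x ∈ S → y ∈ S → u ~ x → u ~ y → Comparable S x y)

  CycAdj : (k : ℕ) → Fin k → Fin k → Set
  CycAdj k i j =
    suc (toℕ i) ≡ toℕ j ⊎ suc (toℕ j) ≡ toℕ i ⊎
    (toℕ i ≡ 0 × suc (toℕ j) ≡ k) ⊎ (toℕ j ≡ 0 × suc (toℕ i) ≡ k)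

  InducedCycle : Subset n → (k : ℕ) → (Fin k → Fin n) → Set
  InducedCycle X k f =
    Injective _≡_ _≡_ f ×
    (∀ i → f i ∈ X) ×
    (∀ i j → (f i ~ f j) ⇔ CycAdj k i j)

  Bipartite : Subset n → Set
  Bipartite X = Σ (Fin n → Fin 2) λ c → (∀ x y → x ∈ X → y ∈ X → x ~ y → c x ≢ c y)

  -- solution: G[X] chordal bipartite
  Solution : Subset n → Set
  Solution X =
    Bipartite X ×
    (∀ k (f : Fin k → Fin n) → 6 ≤ k → ¬ InducedCycle X k f)

  AWS : Subset n → Fin n → Set
  AWS X u = u ∉ X × WeakSimplicial (X ∪ ⁅ u ⁆) u

  N12 : Fin n → Fin n → Set
  N12 v u = u ≢ v × (v ~ u ⊎ ∃[ w ] (v ~ w × w ~ u))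

  DelAWS : Subset n → Fin n → Fin n → Set
  DelAWS X v u =
    N12 v u × AWS X u × ¬ WeakSimplicial (X ∪ ⁅ u ⁆ ∪ ⁅ v ⁆) u

-- Adjacent vertices of G[S] are never comparable (G is loopless). Hence if every
-- neighbour w of u in Z = X ∪ {u} ∪ {v} is comparable to v, no such w is adjacent
-- to v; adding v then changes neither the neighbourhoods inside N(u) nor their
-- independence, so u stays weak-simplicial in Z. Conversely, as u ~ v, a neighbour
-- w of u incomparable to v violates weak-simpliciality of u in Z directly.
module Submission where

open import Defs
open import Data.Nat using (ℕ)
open import Data.Fin using (Fin)
open import Data.Fin.Subset using (Subset; _∈_; _∪_; ⁅_⁆)
open import Data.Fin.Subset.Properties using (_∈?_; x∈p∪q⁻; p⊆p∪q; q⊆p∪q; x∈⁅x⁆; x∈⁅y⁆⇒x≡y; ∪-assoc)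
open import Data.Fin.Properties using (all?; any?)
open import Data.Product using (∃-syntax; _×_; _,_)
open import Data.Sum using (_⊎_; inj₁; inj₂)
open import Data.Empty using (⊥-elim)
open import Function.Bundles using (_⇔_; mk⇔; Equivalence)
open import Relation.Nullary using (¬_; Dec; yes; no)
open import Relation.Nullary.Decidable using (¬?; _⊎-dec_; _→-dec_; _×-dec_; decidable-stable)
open import Relation.Binary.PropositionalEquality using (_≡_; refl; subst)

∈-∪⁅⁆⁻ : ∀ {n} {S : Subset n} {v x : Fin n} → x ∈ S ∪ ⁅ v ⁆ → x ∈ S ⊎ x ≡ v
∈-∪⁅⁆⁻ {S = S} {v} x∈ with x∈p∪q⁻ S ⁅ v ⁆ x∈
... | inj₁ x∈S  = inj₁ x∈S
... | inj₂ x∈⁅v⁆ = inj₂ (x∈⁅y⁆⇒x≡y v x∈⁅v⁆)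

v∈S∪⁅v⁆ : ∀ {n} (S : Subset n) v → v ∈ S ∪ ⁅ v ⁆
v∈S∪⁅v⁆ S v = q⊆p∪q S ⁅ v ⁆ (x∈⁅x⁆ v)

module _ {n : ℕ} (G : Graph n) where
  open Graph G

  NSub? : ∀ S a b → Dec (NSub G S a b)
  NSub? S a b = all? λ x → x ∈? S →-dec (~-dec a x →-dec ~-dec b x)

  Comparable? : ∀ S a b → Dec (Comparable G S a b)
  Comparable? S a b = NSub? S a b ⊎-dec NSub? S b a

  Comparable-sym : ∀ {S a b} → Comparable G S a b → Comparable G S b a
  Comparable-sym (inj₁ a⊆b) = inj₂ a⊆b
  Comparable-sym (inj₂ b⊆a) = inj₁ b⊆a

  adjacent⇒incomparable : ∀ {S a b} → a ∈ S → b ∈ S → a ~ b → Incomparable G S a b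
  adjacent⇒incomparable a∈S b∈S a~b (inj₁ a⊆b) = ~-irr (a⊆b _ b∈S a~b)
  adjacent⇒incomparable a∈S b∈S a~b (inj₂ b⊆a) = ~-irr (b⊆a _ a∈S (~-sym a~b))

  comparable⇒nonadjacent : ∀ {S a b} → a ∈ S → b ∈ S → Comparable G S a b → ¬ a ~ b
  comparable⇒nonadjacent a∈S b∈S a≈b a~b = adjacent⇒incomparable a∈S b∈S a~b a≈b

  NSub-∪⁅⁆ : ∀ {S v a b} → ¬ a ~ v → NSub G S a b → NSub G (S ∪ ⁅ v ⁆) a b
  NSub-∪⁅⁆ a≁v a⊆b x x∈ a~x with ∈-∪⁅⁆⁻ x∈
  ... | inj₁ x∈S = a⊆b x x∈S a~x
  ... | inj₂ refl = ⊥-elim (a≁v a~x)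

  Comparable-∪⁅⁆ : ∀ {S v a b} → ¬ a ~ v → ¬ b ~ v →
    Comparable G S a b → Comparable G (S ∪ ⁅ v ⁆) a b
  Comparable-∪⁅⁆ a≁v b≁v (inj₁ a⊆b) = inj₁ (NSub-∪⁅⁆ a≁v a⊆b)
  Comparable-∪⁅⁆ a≁v b≁v (inj₂ b⊆a) = inj₂ (NSub-∪⁅⁆ b≁v b⊆a)

  WeakSimplicial-∪⁅⁆ : ∀ {S u v} → WeakSimplicial G S u →
    (∀ w → w ∈ S ∪ ⁅ v ⁆ → u ~ w → Comparable G (S ∪ ⁅ v ⁆) w v) →
    WeakSimplicial G (S ∪ ⁅ v ⁆) u
  WeakSimplicial-∪⁅⁆ {S} {u} {v} (u∈S , independent , comparable) w≈v =
    p⊆p∪q ⁅ v ⁆ u∈S , independent′ , comparable′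
    where
    Z = S ∪ ⁅ v ⁆

    ≁v : ∀ {w} → w ∈ Z → u ~ w → ¬ w ~ v
    ≁v w∈Z u~w = comparable⇒nonadjacent w∈Z (v∈S∪⁅v⁆ S v) (w≈v _ w∈Z u~w)

    independent′ : ∀ x y → x ∈ Z → y ∈ Z → u ~ x → u ~ y → ¬ x ~ y
    independent′ x y x∈ y∈ u~x u~y with ∈-∪⁅⁆⁻ x∈ | ∈-∪⁅⁆⁻ y∈
    ... | inj₁ x∈S | inj₁ y∈S = independent x y x∈S y∈S u~x u~y
    ... | inj₂ refl | _        = λ v~y → ≁v y∈ u~y (~-sym v~y)
    ... | inj₁ _   | inj₂ refl = ≁v x∈ u~x

    comparable′ : ∀ x y → x ∈ Z → y ∈ Z → u ~ x → u ~ y → Comparable G Z x y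
    comparable′ x y x∈ y∈ u~x u~y with ∈-∪⁅⁆⁻ x∈ | ∈-∪⁅⁆⁻ y∈
    ... | inj₁ x∈S | inj₁ y∈S =
      Comparable-∪⁅⁆ (≁v x∈ u~x) (≁v y∈ u~y) (comparable x y x∈S y∈S u~x u~y)
    ... | inj₂ refl | _        = Comparable-sym (w≈v y y∈ u~y)
    ... | inj₁ _   | inj₂ refl = w≈v x x∈ u~x

  -- Decidability of every relation involved turns the failure of
  -- weak-simpliciality into an explicit witness.
  ¬WeakSimplicial-∪⁅⁆⇔ : ∀ {S u v} → WeakSimplicial G S u → u ~ v →
    (¬ WeakSimplicial G (S ∪ ⁅ v ⁆) u) ⇔
      (∃[ w ] (w ∈ S ∪ ⁅ v ⁆ × u ~ w × Incomparable G (S ∪ ⁅ v ⁆) w v))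
  ¬WeakSimplicial-∪⁅⁆⇔ {S} {u} {v} u-ws u~v = mk⇔ witness refute
    where
    Z = S ∪ ⁅ v ⁆

    witness : ¬ WeakSimplicial G Z u →
      ∃[ w ] (w ∈ Z × u ~ w × Incomparable G Z w v)
    witness ¬ws with any? (λ w → w ∈? Z ×-dec (~-dec u w ×-dec ¬? (Comparable? Z w v)))
    ... | yes w = w
    ... | no ∄w = ⊥-elim (¬ws (WeakSimplicial-∪⁅⁆ u-ws λ w w∈Z u~w →
      decidable-stable (Comparable? Z w v) λ w≉v → ∄w (w , w∈Z , u~w , w≉v)))

    refute : ∃[ w ] (w ∈ Z × u ~ w × Incomparable G Z w v) →
      ¬ WeakSimplicial G Z u
    refute (w , w∈Z , u~w , w≉v) (_ , _ , comparable) =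
      w≉v (comparable w v w∈Z (v∈S∪⁅v⁆ S v) u~w u~v)

lemma11 : ∀ {n} (G : Graph n) (X : Subset n) (v u : Fin n) →
    Solution G X → AWS G X v → Solution G (X ∪ ⁅ v ⁆) →
    Graph._~_ G v u → AWS G X u →
    (DelAWS G X v u ⇔
      (∃[ w ] (w ∈ (X ∪ ⁅ u ⁆ ∪ ⁅ v ⁆) × Graph._~_ G u w ×
               Incomparable G (X ∪ ⁅ u ⁆ ∪ ⁅ v ⁆) w v)))
lemma11 G X v u _ _ _ v~u u-aws@(_ , u-ws) =
  mk⇔ (λ (_ , _ , ¬ws) → to ¬ws) (λ w → u∈N¹²v , u-aws , from w)
  where
  open Graph G

  u∈N¹²v : N12 G v u
  u∈N¹²v = (λ { refl → ~-irr v~u }) , inj₁ v~u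

  -- _∪_ associates to the right, so Z = X ∪ (⁅ u ⁆ ∪ ⁅ v ⁆) in the statement.
  open Equivalence (subst
    (λ Z → (¬ WeakSimplicial G Z u) ⇔ (∃[ w ] (w ∈ Z × u ~ w × Incomparable G Z w v)))
    (∪-assoc X ⁅ u ⁆ ⁅ v ⁆)
    (¬WeakSimplicial-∪⁅⁆⇔ G u-ws (~-sym v~u)))
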